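{- Let $\boldsymbol w\in\{0,1\}^\omega$ be such that $0101\boldsymbol w$ is faux-bonacci. Then $10101\boldsymbol w$ is faux-bonacci.
   Context: For non-empty $X$, $X^-$ is $X$ with its last letter erased; a $4^-$-power is $XXXX^-$ with $X$ non-empty; a binary word is faux-bonacci if it has no factor $11$ and no factor that is a $4^-$-power. -}

module Defs where

open import Data.Bool using (Bool; true; false)
open import Data.Nat using (ℕ; zero; suc; _+_)
open import Data.List using (List; []; _∷_; _++_; length)
open import Data.Product using (Σ; ∃; _×_; _,_)
open import Relation.Binary.PropositionalEquality using (_≡_; _≢_)
open import Relation.Nullary using (¬_)

-- Binary letters: false = 0, true = 1.
-- Infinite (one-sided, ω-) binary words.
ωWord : Set
ωWord = ℕ → Bool

infixr 5 _++ω_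
_++ω_ : List Bool → ωWord → ωWord
([]     ++ω w) n       = w n
((x ∷ u) ++ω w) zero    = x
((x ∷ u) ++ω w) (suc n) = (u ++ω w) n

slice : ωWord → ℕ → ℕ → List Bool
slice w i zero    = []
slice w i (suc n) = w i ∷ slice w (suc i) n

Factor : List Bool → ωWord → Set
Factor u w = ∃ λ i → slice w i (length u) ≡ u

-- X⁻ : X with its last letter erased (identity on the empty word, unused there).
_⁻ : {A : Set} → List A → List A
[] ⁻               = []
(x ∷ []) ⁻         = []
(x ∷ y ∷ xs) ⁻     = x ∷ ((y ∷ xs) ⁻)

Is4⁻Power : List Bool → Set
Is4⁻Power u = ∃ λ (X : List Bool) → X ≢ [] × u ≡ X ++ X ++ X ++ (X ⁻)

FauxBonacci : ωWord → Set
FauxBonacci w = ¬ Factor (true ∷ true ∷ []) w × (∀ u → Is4⁻Power u → ¬ Factor u w)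

{-# OPTIONS --safe #-}
module Submission where

-- A bad factor of 1·v that is not already a factor of v is a prefix of it.
-- The word 10101w has no prefix 11, and a prefix XXXX⁻ (for |X| ≠ 1, 3, which
-- clash with 10101) makes 10101 recur at position |X| ≥ 2, hence inside 0101w
-- with a letter on each side. Both neighbours are 0 since 11 is excluded, and
-- then 0101010 = (01)(01)(01)(01)⁻ is a 4⁻-power.

open import Defs
open import Data.Bool using (Bool; true; false)
open import Data.Empty using (⊥; ⊥-elim)
open import Data.List using (List; []; _∷_; _++_; length)
open import Data.List.Properties using (∷-injective)
open import Data.Nat using (ℕ; zero; suc; _+_)
open import Data.Nat.Properties using (+-suc; +-identityʳ)
open import Data.Product using (∃; _×_; _,_)
open import Function using (_∘_)
open import Relation.Binary.PropositionalEquality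
open import Relation.Nullary using (¬_)

⟨10101⟩ : List Bool
⟨10101⟩ = true ∷ false ∷ true ∷ false ∷ true ∷ []

slice-suc : (f : ωWord) (i n : ℕ) → slice f (suc i) n ≡ slice (f ∘ suc) i n
slice-suc f i zero    = refl
slice-suc f i (suc n) = cong (f (suc i) ∷_) (slice-suc f (suc i) n)

slice-++⁻ : (f : ωWord) (i : ℕ) (u r : List Bool) →
  slice f i (length (u ++ r)) ≡ u ++ r →
  slice f i (length u) ≡ u × slice f (i + length u) (length r) ≡ r
slice-++⁻ f i []      r e =
  refl , subst (λ m → slice f m (length r) ≡ r) (sym (+-identityʳ i)) e
slice-++⁻ f i (a ∷ u) r e with ∷-injective e
... | refl , e′ with slice-++⁻ f (suc i) u r e′
... | eᵤ , eᵣ =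
  cong (a ∷_) eᵤ , subst (λ m → slice f m (length r) ≡ r) (sym (+-suc i (length u))) eᵣ

Factor-infix : ∀ p u q {f : ωWord} → Factor (p ++ u ++ q) f → Factor u f
Factor-infix p u q {f} (i , e) with slice-++⁻ f i p (u ++ q) e
... | _ , e′ with slice-++⁻ f (i + length p) u q e′
... | eᵤ , _ = i + length p , eᵤ

FauxBonacci-fromTail : (f : ωWord) → FauxBonacci (f ∘ suc) →
  slice f 0 2 ≢ true ∷ true ∷ [] →
  (∀ u → Is4⁻Power u → slice f 0 (length u) ≢ u) →
  FauxBonacci f
FauxBonacci-fromTail f (no11 , no4⁻) no11-prefix no4⁻-prefix = no11′ , no4⁻′
  where
  no11′ : ¬ Factor (true ∷ true ∷ []) f
  no11′ (zero  , e) = no11-prefix e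
  no11′ (suc i , e) = no11 (i , trans (sym (slice-suc f i 2)) e)

  no4⁻′ : ∀ u → Is4⁻Power u → ¬ Factor u f
  no4⁻′ u p (zero  , e) = no4⁻-prefix u p e
  no4⁻′ u p (suc i , e) = no4⁻ u p (i , trans (sym (slice-suc f i (length u))) e)

10101-unextendable : (v : ωWord) → FauxBonacci v → (k : ℕ) → slice v (suc k) 5 ≢ ⟨10101⟩
10101-unextendable v (no11 , no4⁻) k e = neighbours (v k) (v (6 + k)) window
  where
  window : Factor (v k ∷ ⟨10101⟩ ++ v (6 + k) ∷ []) v
  window = k , cong (λ m → v k ∷ m ++ v (6 + k) ∷ []) e

  neighbours : ∀ a b → Factor (a ∷ ⟨10101⟩ ++ b ∷ []) v → ⊥
  neighbours true  _     = no11 ∘ Factor-infix [] _ _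
  neighbours false true  = no11 ∘ Factor-infix (false ∷ true ∷ false ∷ true ∷ false ∷ []) _ []
  neighbours false false = no4⁻ _ ((false ∷ true ∷ []) , (λ ()) , refl)

4⁻-power-prefix-repeats-10101 : (w : ωWord) (X : List Bool) → X ≢ [] →
  slice (⟨10101⟩ ++ω w) 0 (length (X ++ X ++ X ++ X ⁻)) ≡ X ++ X ++ X ++ X ⁻ →
  ∃ λ k → slice (⟨10101⟩ ++ω w) (2 + k) 5 ≡ ⟨10101⟩
4⁻-power-prefix-repeats-10101 w X X≢[] e with slice-++⁻ (⟨10101⟩ ++ω w) 0 X _ e
... | eˣ , eʳ = repeat X X≢[] eˣ eʳ
  where
  s : ωWord
  s = ⟨10101⟩ ++ω w

  first-five : ∀ {i} r → slice s i (length (⟨10101⟩ ++ r)) ≡ ⟨10101⟩ ++ r → slice s i 5 ≡ ⟨10101⟩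
  first-five {i} r e = let e₅ , _ = slice-++⁻ s i ⟨10101⟩ r e in e₅

  repeat : (X : List Bool) → X ≢ [] → slice s 0 (length X) ≡ X →
    slice s (length X) (length (X ++ X ++ X ⁻)) ≡ X ++ X ++ X ⁻ →
    ∃ λ k → slice s (2 + k) 5 ≡ ⟨10101⟩
  repeat []                     X≢[] _    _  = ⊥-elim (X≢[] refl)
  repeat (_ ∷ [])               _    refl ()
  repeat (_ ∷ _ ∷ [])           _    refl eʳ = 0 , eʳ
  repeat (_ ∷ _ ∷ _ ∷ [])       _    refl ()
  repeat (_ ∷ _ ∷ _ ∷ _ ∷ [])   _    refl eʳ = 2 , first-five _ eʳ
  repeat (a ∷ b ∷ c ∷ d ∷ e ∷ Y) _   eˣ   eʳ
    with slice-++⁻ s 0 (a ∷ b ∷ c ∷ d ∷ e ∷ []) Y eˣ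
  ... | refl , _ = 3 + length Y , first-five _ eʳ

lemma3 : (w : ωWord) →
    FauxBonacci ((false ∷ true ∷ false ∷ true ∷ []) ++ω w) →
    FauxBonacci ((true ∷ false ∷ true ∷ false ∷ true ∷ []) ++ω w)
lemma3 w fb = FauxBonacci-fromTail s fb (λ ()) no4⁻-prefix
  where
  s : ωWord
  s = ⟨10101⟩ ++ω w

  no4⁻-prefix : ∀ u → Is4⁻Power u → slice s 0 (length u) ≢ u
  no4⁻-prefix _ (X , X≢[] , refl) e with 4⁻-power-prefix-repeats-10101 w X X≢[] e
  ... | k , e′ = 10101-unextendable (s ∘ suc) fb k (trans (sym (slice-suc s (suc k) 5)) e′)
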